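{- For every formula $\phi$: (1) $\mathrm{voc}(\phi)=\mathrm{voc}(\phi^\sharp)$; (2) $\mathsf{ILP}\vdash\phi\leftrightarrow\phi^\sharp$; (3) if $\mathsf{ILP}\vdash\phi$ then $\mathsf{IL}\vdash\phi^\sharp$.
   Context: Formulas: $\phi ::= p \mid \bot \mid \phi\to\phi \mid \phi\rhd\phi$; $\mathrm{voc}(\phi)$ is the set of variables of $\phi$. Abbreviations: $\neg\phi := \phi\to\bot$, $\phi\vee\psi := \neg\phi\to\psi$, $\phi\wedge\psi := \neg(\phi\to\neg\psi)$, $\Box\phi := \neg\phi\rhd\bot$, $\Diamond\phi := \neg(\phi\rhd\bot)$, $\boxdot\phi := \phi\wedge\Box\phi$. $\mathsf{IL}$ is the smallest set of formulas containing all classical propositional tautologies and all instances of (K) $\Box(\phi\to\psi)\to(\Box\phi\to\Box\psi)$, (4) $\Box\phi\to\Box\Box\phi$, (L) $\Box(\Box\phi\to\phi)\to\Box\phi$, (J1) $\Box(\phi\to\psi)\to(\phi\rhd\psi)$, (J2) $(\phi\rhd\chi)\wedge(\chi\rhd\psi)\to(\phi\rhd\psi)$, (J3) $(\phi\rhd\psi)\wedge(\chi\rhd\psi)\to((\phi\vee\chi)\rhd\psi)$, (J4) $\phi\rhd\psi\to(\Diamond\phi\to\Diamond\psi)$, (J5) $\Diamond\phi\rhd\phi$, closed under modus ponens and necessitation. $\mathsf{ILP}$ is $\mathsf{IL}$ extended with the axiom scheme (P) $\phi\rhd\psi\to\Box(\phi\rhd\psi)$. The translation $(\cdot)^\sharp$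 is defined by $p^\sharp=p$, $\bot^\sharp=\bot$, $(\phi\to\psi)^\sharp=\phi^\sharp\to\psi^\sharp$, $(\phi\rhd\psi)^\sharp=\boxdot(\phi^\sharp\rhd\psi^\sharp)$. -}

module Defs where

open import Data.Nat using (ℕ)
open import Data.Bool using (Bool; true; false; not; _∨_)
open import Data.List using (List; []; [_]; _++_)
open import Relation.Binary.PropositionalEquality using (_≡_)

infixr 6 _⇒_
infix 7 _▷_
data Fm : Set where
  var : ℕ → Fm
  ⊥'  : Fm
  _⇒_ : Fm → Fm → Fm
  _▷_ : Fm → Fm → Fm

¬' : Fm → Fm
¬' φ = φ ⇒ ⊥'

_∨'_ : Fm → Fm → Fm
φ ∨' ψ = ¬' φ ⇒ ψ

_∧'_ : Fm → Fm → Fm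
φ ∧' ψ = ¬' (φ ⇒ ¬' ψ)

_⇔'_ : Fm → Fm → Fm
φ ⇔' ψ = (φ ⇒ ψ) ∧' (ψ ⇒ φ)

□ : Fm → Fm
□ φ = ¬' φ ▷ ⊥'

◇ : Fm → Fm
◇ φ = ¬' (φ ▷ ⊥')

⊡ : Fm → Fm
⊡ φ = φ ∧' □ φ

voc : Fm → List ℕ
voc (var n) = [ n ]
voc ⊥' = []
voc (φ ⇒ ψ) = voc φ ++ voc ψ
voc (φ ▷ ψ) = voc φ ++ voc ψ

-- Classical propositional tautologies: the formula is true under every
-- Boolean assignment to its propositional atoms, where variables and
-- ▷-formulas are treated as atoms (i.e. it is a substitution instance of
-- a propositional tautology).
eval : (Fm → Bool) → Fm → Bool
eval v (var n) = v (var n)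
eval v ⊥' = false
eval v (φ ⇒ ψ) = not (eval v φ) ∨ eval v ψ
eval v (φ ▷ ψ) = v (φ ▷ ψ)

Taut : Fm → Set
Taut φ = (v : Fm → Bool) → eval v φ ≡ true

data IL⊢_ : Fm → Set where
  taut : ∀ {φ} → Taut φ → IL⊢ φ
  axK  : ∀ φ ψ → IL⊢ (□ (φ ⇒ ψ) ⇒ (□ φ ⇒ □ ψ))
  ax4  : ∀ φ → IL⊢ (□ φ ⇒ □ (□ φ))
  axL  : ∀ φ → IL⊢ (□ (□ φ ⇒ φ) ⇒ □ φ)
  axJ1 : ∀ φ ψ → IL⊢ (□ (φ ⇒ ψ) ⇒ (φ ▷ ψ))
  axJ2 : ∀ φ χ ψ → IL⊢ (((φ ▷ χ) ∧' (χ ▷ ψ)) ⇒ (φ ▷ ψ))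
  axJ3 : ∀ φ χ ψ → IL⊢ (((φ ▷ ψ) ∧' (χ ▷ ψ)) ⇒ ((φ ∨' χ) ▷ ψ))
  axJ4 : ∀ φ ψ → IL⊢ ((φ ▷ ψ) ⇒ (◇ φ ⇒ ◇ ψ))
  axJ5 : ∀ φ → IL⊢ (◇ φ ▷ φ)
  mp   : ∀ {φ ψ} → IL⊢ (φ ⇒ ψ) → IL⊢ φ → IL⊢ ψ
  nec  : ∀ {φ} → IL⊢ φ → IL⊢ (□ φ)

data ILP⊢_ : Fm → Set where
  taut : ∀ {φ} → Taut φ → ILP⊢ φ
  axK  : ∀ φ ψ → ILP⊢ (□ (φ ⇒ ψ) ⇒ (□ φ ⇒ □ ψ))
  ax4  : ∀ φ → ILP⊢ (□ φ ⇒ □ (□ φ))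
  axL  : ∀ φ → ILP⊢ (□ (□ φ ⇒ φ) ⇒ □ φ)
  axJ1 : ∀ φ ψ → ILP⊢ (□ (φ ⇒ ψ) ⇒ (φ ▷ ψ))
  axJ2 : ∀ φ χ ψ → ILP⊢ (((φ ▷ χ) ∧' (χ ▷ ψ)) ⇒ (φ ▷ ψ))
  axJ3 : ∀ φ χ ψ → ILP⊢ (((φ ▷ ψ) ∧' (χ ▷ ψ)) ⇒ ((φ ∨' χ) ▷ ψ))
  axJ4 : ∀ φ ψ → ILP⊢ ((φ ▷ ψ) ⇒ (◇ φ ⇒ ◇ ψ))
  axJ5 : ∀ φ → ILP⊢ (◇ φ ▷ φ)
  axP  : ∀ φ ψ → ILP⊢ ((φ ▷ ψ) ⇒ □ (φ ▷ ψ))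
  mp   : ∀ {φ ψ} → ILP⊢ (φ ⇒ ψ) → ILP⊢ φ → ILP⊢ ψ
  nec  : ∀ {φ} → ILP⊢ φ → ILP⊢ (□ φ)

_♯ : Fm → Fm
var n ♯ = var n
⊥' ♯ = ⊥'
(φ ⇒ ψ) ♯ = (φ ♯) ⇒ (ψ ♯)
(φ ▷ ψ) ♯ = ⊡ ((φ ♯) ▷ (ψ ♯))

-- (1) ⊡χ has exactly the variables of χ. (2) By (P) every ▷-formula is ILP-equivalent to
-- its ⊡-closure, and ▷ respects provable equivalence (by J1 and J2), so φ ↔ φ♯ follows by
-- induction on φ. (3) By induction on the ILP-derivation: ♯ commutes with → and ⊥, so it
-- preserves tautologies and modus ponens; as (□φ)♯ = ⊡□(φ♯), necessitation becomes
-- ⊡-necessitation; and every axiom translates to an IL-theorem. In particular (4) and (P)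
-- both translate to instances of ⊡A → ⊡□⊡A, which IL proves using □A → □⊡A.
module Submission where

open import Defs
open import Data.Nat using (ℕ; zero; suc)
open import Data.Product using (_×_; _,_)
open import Data.Bool using (Bool; true; false; not; _∨_; _≟_)
open import Data.Fin using (Fin; zero; suc)
open import Data.Vec using (Vec; []; _∷_; lookup; map)
open import Data.Vec.Properties using (lookup-map)
open import Data.List using (_++_)
open import Data.List.Properties using (++-identityʳ)
open import Data.List.Membership.Propositional using (_∈_)
open import Data.List.Relation.Binary.BagAndSetEquality
  using (set; _∼[_]_; [_]-Equality; ++-cong; ++-idempotent)
open import Function.Bundles using (_⇔_)
open import Function.Related.Propositional using (K-refl)
open import Relation.Nullary.Decidable using (Dec; True; toWitness; map′; _×-dec_)
open import Relation.Binary.PropositionalEquality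
  using (_≡_; refl; sym; trans; cong; cong₂; module ≡-Reasoning)

voc-¬ : ∀ φ → voc (¬' φ) ≡ voc φ
voc-¬ φ = ++-identityʳ (voc φ)

voc-□ : ∀ φ → voc (□ φ) ≡ voc φ
voc-□ φ = trans (++-identityʳ (voc (¬' φ))) (voc-¬ φ)

voc-⊡ : ∀ φ → voc (⊡ φ) ≡ voc φ ++ voc φ
voc-⊡ φ = begin
  voc (¬' (φ ⇒ ¬' (□ φ)))   ≡⟨ voc-¬ (φ ⇒ ¬' (□ φ)) ⟩
  voc φ ++ voc (¬' (□ φ))   ≡⟨ cong (voc φ ++_) (trans (voc-¬ (□ φ)) (voc-□ φ)) ⟩
  voc φ ++ voc φ            ∎
  where open ≡-Reasoning

voc-♯ : ∀ φ → voc φ ∼[ set ] voc (φ ♯)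
voc-♯ (var n) = K-refl
voc-♯ ⊥' = K-refl
voc-♯ (φ ⇒ ψ) = ++-cong (voc-♯ φ) (voc-♯ ψ)
voc-♯ (φ ▷ ψ) = begin
  voc φ ++ voc ψ      ≈⟨ ++-cong (voc-♯ φ) (voc-♯ ψ) ⟩
  voc χ               ≈⟨ ++-idempotent (voc χ) ⟨
  voc χ ++ voc χ      ≡⟨ voc-⊡ χ ⟨
  voc (⊡ χ)           ∎
  where
  χ = φ ♯ ▷ ψ ♯
  open import Relation.Binary.Reasoning.Setoid ([ set ]-Equality ℕ)

-- Propositional schemas in n metavariables: validity is decided by enumerating valuations,
-- and every instance of a valid schema is a tautology in the sense of Taut.
infixr 6 _⟶_
data Schema (n : ℕ) : Set where
  at   : Fin n → Schema n
  ff   : Schema n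
  _⟶_ : Schema n → Schema n → Schema n

pattern x₀ = at zero
pattern x₁ = at (suc zero)
pattern x₂ = at (suc (suc zero))
pattern x₃ = at (suc (suc (suc zero)))
pattern x₄ = at (suc (suc (suc (suc zero))))
pattern x₅ = at (suc (suc (suc (suc (suc zero)))))

¬ˢ : ∀ {n} → Schema n → Schema n
¬ˢ p = p ⟶ ff

infixr 7 _∧ˢ_
_∧ˢ_ : ∀ {n} → Schema n → Schema n → Schema n
p ∧ˢ q = ¬ˢ (p ⟶ ¬ˢ q)

infix 5 _⇔ˢ_
_⇔ˢ_ : ∀ {n} → Schema n → Schema n → Schema n
p ⇔ˢ q = (p ⟶ q) ∧ˢ (q ⟶ p)

⟦_⟧ : ∀ {n} → Schema n → Vec Bool n → Bool
⟦ at i ⟧ ρ = lookup ρ i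
⟦ ff ⟧ ρ = false
⟦ p ⟶ q ⟧ ρ = not (⟦ p ⟧ ρ) ∨ ⟦ q ⟧ ρ

inst : ∀ {n} → Vec Fm n → Schema n → Fm
inst σ (at i) = lookup σ i
inst σ ff = ⊥'
inst σ (p ⟶ q) = inst σ p ⇒ inst σ q

eval-inst : ∀ {n} v (σ : Vec Fm n) p → eval v (inst σ p) ≡ ⟦ p ⟧ (map (eval v) σ)
eval-inst v σ (at i) = sym (lookup-map i (eval v) σ)
eval-inst v σ ff = refl
eval-inst v σ (p ⟶ q) = cong₂ (λ a b → not a ∨ b) (eval-inst v σ p) (eval-inst v σ q)

all-valuations? : ∀ n {P : Vec Bool n → Set} → (∀ ρ → Dec (P ρ)) → Dec (∀ ρ → P ρ)
all-valuations? zero P? = map′ (λ { p [] → p }) (λ h → h []) (P? [])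
all-valuations? (suc n) P? =
  map′ (λ { (t , f) (true ∷ ρ) → t ρ ; (t , f) (false ∷ ρ) → f ρ })
       (λ h → (λ ρ → h (true ∷ ρ)) , (λ ρ → h (false ∷ ρ)))
       (all-valuations? n (λ ρ → P? (true ∷ ρ)) ×-dec all-valuations? n (λ ρ → P? (false ∷ ρ)))

Valid : ∀ {n} → Schema n → Set
Valid p = ∀ ρ → ⟦ p ⟧ ρ ≡ true

valid? : ∀ {n} (p : Schema n) → Dec (Valid p)
valid? {n} p = all-valuations? n (λ ρ → ⟦ p ⟧ ρ ≟ true)

inst-taut : ∀ {n} (σ : Vec Fm n) p → Valid p → Taut (inst σ p)
inst-taut σ p valid v = trans (eval-inst v σ p) (valid (map (eval v) σ))

module ILReasoning {⊢_ : Fm → Set}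
  (fromIL : ∀ {φ} → IL⊢ φ → ⊢ φ)
  (mp : ∀ {φ ψ} → ⊢ (φ ⇒ ψ) → ⊢ φ → ⊢ ψ)
  (nec : ∀ {φ} → ⊢ φ → ⊢ □ φ)
  where

  tautology : ∀ {n} (σ : Vec Fm n) (p : Schema n) {_ : True (valid? p)} → ⊢ inst σ p
  tautology σ p {valid} = fromIL (taut (inst-taut σ p (toWitness valid)))

  mp₂ : ∀ {A B C} → ⊢ (A ⇒ B ⇒ C) → ⊢ A → ⊢ B → ⊢ C
  mp₂ h a b = mp (mp h a) b

  ⇒-refl : ∀ {A} → ⊢ (A ⇒ A)
  ⇒-refl {A} = tautology (A ∷ []) (x₀ ⟶ x₀)

  ⇒-precomp : ∀ {A B C} → ⊢ (A ⇒ B) → ⊢ ((B ⇒ C) ⇒ (A ⇒ C))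
  ⇒-precomp {A} {B} {C} = mp (tautology (A ∷ B ∷ C ∷ []) ((x₀ ⟶ x₁) ⟶ (x₁ ⟶ x₂) ⟶ (x₀ ⟶ x₂)))

  ⇒-trans : ∀ {A B C} → ⊢ (A ⇒ B) → ⊢ (B ⇒ C) → ⊢ (A ⇒ C)
  ⇒-trans h = mp (⇒-precomp h)

  ⇒-mp : ∀ {A B C} → ⊢ (A ⇒ B ⇒ C) → ⊢ (A ⇒ B) → ⊢ (A ⇒ C)
  ⇒-mp {A} {B} {C} = mp₂ (tautology (A ∷ B ∷ C ∷ []) ((x₀ ⟶ x₁ ⟶ x₂) ⟶ (x₀ ⟶ x₁) ⟶ (x₀ ⟶ x₂)))

  ∧-pair : ∀ {A B} → ⊢ (A ⇒ B ⇒ A ∧' B)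
  ∧-pair {A} {B} = tautology (A ∷ B ∷ []) (x₀ ⟶ x₁ ⟶ x₀ ∧ˢ x₁)

  ∧-intro : ∀ {A B} → ⊢ A → ⊢ B → ⊢ (A ∧' B)
  ∧-intro = mp₂ ∧-pair

  ∧-elimˡ : ∀ {A B} → ⊢ (A ∧' B ⇒ A)
  ∧-elimˡ {A} {B} = tautology (A ∷ B ∷ []) (x₀ ∧ˢ x₁ ⟶ x₀)

  ∧-elimʳ : ∀ {A B} → ⊢ (A ∧' B ⇒ B)
  ∧-elimʳ {A} {B} = tautology (A ∷ B ∷ []) (x₀ ∧ˢ x₁ ⟶ x₁)

  ⇒-∧-intro : ∀ {A B C} → ⊢ (A ⇒ B) → ⊢ (A ⇒ C) → ⊢ (A ⇒ B ∧' C)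
  ⇒-∧-intro h₁ h₂ = ⇒-mp (⇒-trans h₁ ∧-pair) h₂

  ∧-curry : ∀ {A B C} → ⊢ (A ∧' B ⇒ C) → ⊢ (A ⇒ B ⇒ C)
  ∧-curry {A} {B} {C} = mp (tautology (A ∷ B ∷ C ∷ []) ((x₀ ∧ˢ x₁ ⟶ x₂) ⟶ (x₀ ⟶ x₁ ⟶ x₂)))

  ∧-uncurry : ∀ {A B C} → ⊢ (A ⇒ B ⇒ C) → ⊢ (A ∧' B ⇒ C)
  ∧-uncurry {A} {B} {C} = mp (tautology (A ∷ B ∷ C ∷ []) ((x₀ ⟶ x₁ ⟶ x₂) ⟶ (x₀ ∧ˢ x₁ ⟶ x₂)))

  ∧-dischargeˡ : ∀ {A B C} → ⊢ (A ∧' B ⇒ C) → ⊢ A → ⊢ (B ⇒ C)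
  ∧-dischargeˡ h = mp (∧-curry h)

  ∧-dischargeʳ : ∀ {A B C} → ⊢ (A ∧' B ⇒ C) → ⊢ B → ⊢ (A ⇒ C)
  ∧-dischargeʳ {A} {B} {C} = mp₂ (tautology (A ∷ B ∷ C ∷ []) ((x₀ ∧ˢ x₁ ⟶ x₂) ⟶ x₁ ⟶ (x₀ ⟶ x₂)))

  ⇔-intro : ∀ {A B} → ⊢ (A ⇒ B) → ⊢ (B ⇒ A) → ⊢ (A ⇔' B)
  ⇔-intro = ∧-intro

  ⇔-elimˡ : ∀ {A B} → ⊢ (A ⇔' B) → ⊢ (A ⇒ B)
  ⇔-elimˡ = mp ∧-elimˡ

  ⇔-elimʳ : ∀ {A B} → ⊢ (A ⇔' B) → ⊢ (B ⇒ A)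
  ⇔-elimʳ = mp ∧-elimʳ

  ⇔-refl : ∀ {A} → ⊢ (A ⇔' A)
  ⇔-refl = ⇔-intro ⇒-refl ⇒-refl

  ⇔-trans : ∀ {A B C} → ⊢ (A ⇔' B) → ⊢ (B ⇔' C) → ⊢ (A ⇔' C)
  ⇔-trans h₁ h₂ = ⇔-intro (⇒-trans (⇔-elimˡ h₁) (⇔-elimˡ h₂)) (⇒-trans (⇔-elimʳ h₂) (⇔-elimʳ h₁))

  ⇒-cong : ∀ {A A' B B'} → ⊢ (A ⇔' A') → ⊢ (B ⇔' B') → ⊢ ((A ⇒ B) ⇔' (A' ⇒ B'))
  ⇒-cong {A} {A'} {B} {B'} = mp₂ (tautology (A ∷ A' ∷ B ∷ B' ∷ [])
    ((x₀ ⇔ˢ x₁) ⟶ (x₂ ⇔ˢ x₃) ⟶ ((x₀ ⟶ x₂) ⇔ˢ (x₁ ⟶ x₃))))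

  □-mono : ∀ {A B} → ⊢ (A ⇒ B) → ⊢ (□ A ⇒ □ B)
  □-mono {A} {B} h = mp (fromIL (axK A B)) (nec h)

  □-mono₂ : ∀ {A B C} → ⊢ (A ⇒ B ⇒ C) → ⊢ (□ A ⇒ □ B ⇒ □ C)
  □-mono₂ {B = B} {C} h = ⇒-trans (□-mono h) (fromIL (axK B C))

  □⇒⊡□ : ∀ {A} → ⊢ (□ A ⇒ ⊡ (□ A))
  □⇒⊡□ {A} = ⇒-∧-intro ⇒-refl (fromIL (ax4 A))

  □⇒□⊡ : ∀ {A} → ⊢ (□ A ⇒ □ (⊡ A))
  □⇒□⊡ {A} = ⇒-mp (□-mono₂ ∧-pair) (fromIL (ax4 A))

  ⊡-nec : ∀ {A} → ⊢ A → ⊢ ⊡ A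
  ⊡-nec h = ∧-intro h (nec h)

  ⊡-mono : ∀ {A B} → ⊢ (A ⇒ B) → ⊢ (⊡ A ⇒ ⊡ B)
  ⊡-mono h = ⇒-∧-intro (⇒-trans ∧-elimˡ h) (⇒-trans ∧-elimʳ (□-mono h))

  ⊡-mono₂ : ∀ {A B C} → ⊢ (A ∧' B ⇒ C) → ⊢ (⊡ A ∧' ⊡ B ⇒ ⊡ C)
  ⊡-mono₂ {A} {B} {C} h = mp₂ (tautology (A ∷ B ∷ C ∷ □ A ∷ □ B ∷ □ C ∷ [])
    ((x₀ ∧ˢ x₁ ⟶ x₂) ⟶ (x₃ ⟶ x₄ ⟶ x₅) ⟶ ((x₀ ∧ˢ x₃) ∧ˢ (x₁ ∧ˢ x₄) ⟶ x₂ ∧ˢ x₅)))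
    h (□-mono₂ (∧-curry h))

  ⊡⇒⊡□⊡ : ∀ {A} → ⊢ (⊡ A ⇒ ⊡ (□ (⊡ A)))
  ⊡⇒⊡□⊡ = ⇒-trans ∧-elimʳ (⇒-trans □⇒□⊡ □⇒⊡□)

  ▷-intro : ∀ {A B} → ⊢ (A ⇒ B) → ⊢ (A ▷ B)
  ▷-intro {A} {B} h = mp (fromIL (axJ1 A B)) (nec h)

  ▷-trans : ∀ {A B C} → ⊢ (A ▷ B) → ⊢ (B ▷ C) → ⊢ (A ▷ C)
  ▷-trans {A} {B} {C} h₁ h₂ = mp (fromIL (axJ2 A B C)) (∧-intro h₁ h₂)

  ▷-mono : ∀ {A A' B B'} → ⊢ (A' ⇒ A) → ⊢ (B ⇒ B') → ⊢ ((A ▷ B) ⇒ (A' ▷ B'))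
  ▷-mono {A} {A'} {B} {B'} h₁ h₂ =
    ⇒-trans (∧-dischargeˡ (fromIL (axJ2 A' A B)) (▷-intro h₁))
            (∧-dischargeʳ (fromIL (axJ2 A' B B')) (▷-intro h₂))

  ▷-cong : ∀ {A A' B B'} → ⊢ (A ⇔' A') → ⊢ (B ⇔' B') → ⊢ ((A ▷ B) ⇔' (A' ▷ B'))
  ▷-cong e₁ e₂ = ⇔-intro (▷-mono (⇔-elimʳ e₁) (⇔-elimˡ e₂)) (▷-mono (⇔-elimˡ e₁) (⇔-elimʳ e₂))

IL⊢⇒ILP⊢ : ∀ {φ} → IL⊢ φ → ILP⊢ φ
IL⊢⇒ILP⊢ (taut t) = taut t
IL⊢⇒ILP⊢ (axK φ ψ) = axK φ ψ
IL⊢⇒ILP⊢ (ax4 φ) = ax4 φ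
IL⊢⇒ILP⊢ (axL φ) = axL φ
IL⊢⇒ILP⊢ (axJ1 φ ψ) = axJ1 φ ψ
IL⊢⇒ILP⊢ (axJ2 φ χ ψ) = axJ2 φ χ ψ
IL⊢⇒ILP⊢ (axJ3 φ χ ψ) = axJ3 φ χ ψ
IL⊢⇒ILP⊢ (axJ4 φ ψ) = axJ4 φ ψ
IL⊢⇒ILP⊢ (axJ5 φ) = axJ5 φ
IL⊢⇒ILP⊢ (mp h₁ h₂) = mp (IL⊢⇒ILP⊢ h₁) (IL⊢⇒ILP⊢ h₂)
IL⊢⇒ILP⊢ (nec h) = nec (IL⊢⇒ILP⊢ h)

module ILP = ILReasoning {ILP⊢_} IL⊢⇒ILP⊢ mp nec

▷⇔⊡▷ : ∀ {A B} → ILP⊢ ((A ▷ B) ⇔' ⊡ (A ▷ B))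
▷⇔⊡▷ {A} {B} = mp (ILP.tautology ((A ▷ B) ∷ □ (A ▷ B) ∷ []) ((x₀ ⟶ x₁) ⟶ (x₀ ⇔ˢ x₀ ∧ˢ x₁))) (axP A B)

ILP⊢⇔♯ : ∀ φ → ILP⊢ (φ ⇔' (φ ♯))
ILP⊢⇔♯ (var n) = ILP.⇔-refl
ILP⊢⇔♯ ⊥' = ILP.⇔-refl
ILP⊢⇔♯ (φ ⇒ ψ) = ILP.⇒-cong (ILP⊢⇔♯ φ) (ILP⊢⇔♯ ψ)
ILP⊢⇔♯ (φ ▷ ψ) = ILP.⇔-trans (ILP.▷-cong (ILP⊢⇔♯ φ) (ILP⊢⇔♯ ψ)) ▷⇔⊡▷

eval-♯ : ∀ v φ → eval v (φ ♯) ≡ eval (λ ψ → eval v (ψ ♯)) φ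
eval-♯ v (var n) = refl
eval-♯ v ⊥' = refl
eval-♯ v (φ ⇒ ψ) = cong₂ (λ a b → not a ∨ b) (eval-♯ v φ) (eval-♯ v ψ)
eval-♯ v (φ ▷ ψ) = refl

Taut-♯ : ∀ {φ} → Taut φ → Taut (φ ♯)
Taut-♯ {φ} t v = trans (eval-♯ v φ) (t (λ ψ → eval v (ψ ♯)))

open ILReasoning {IL⊢_} (λ h → h) mp nec

axK-♯ : ∀ A B → IL⊢ (⊡ (□ (A ⇒ B)) ⇒ ⊡ (□ A) ⇒ ⊡ (□ B))
axK-♯ A B = ∧-curry (⊡-mono₂ (∧-uncurry (axK A B)))

axL-♯ : ∀ A → IL⊢ (⊡ (□ (⊡ (□ A) ⇒ A)) ⇒ ⊡ (□ A))
axL-♯ A = ⇒-trans ∧-elimˡ (⇒-trans (□-mono (⇒-precomp □⇒⊡□)) (⇒-trans (axL A) □⇒⊡□))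

axJ4-♯ : ∀ A B → IL⊢ (⊡ (A ▷ B) ⇒ ¬' (⊡ (A ▷ ⊥')) ⇒ ¬' (⊡ (B ▷ ⊥')))
axJ4-♯ A B = mp (tautology (⊡ (A ▷ B) ∷ ⊡ (B ▷ ⊥') ∷ ⊡ (A ▷ ⊥') ∷ [])
  ((x₀ ∧ˢ x₁ ⟶ x₂) ⟶ (x₀ ⟶ ¬ˢ x₂ ⟶ ¬ˢ x₁))) (⊡-mono₂ (axJ2 A B ⊥'))

axJ5-♯ : ∀ A → IL⊢ ⊡ (¬' (⊡ (A ▷ ⊥')) ▷ A)
axJ5-♯ A = ⊡-nec (▷-trans (▷-intro ¬⊡⇒◇∨◇◇) (mp (axJ3 (◇ A) (◇ (◇ A)) A) (∧-intro (axJ5 A) ◇◇▷)))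
  where
  -- ¬ □ (A ▷ ⊥') is literally ◇ (◇ A), since ◇ A = ¬' (A ▷ ⊥').
  ¬⊡⇒◇∨◇◇ : IL⊢ (¬' (⊡ (A ▷ ⊥')) ⇒ ◇ A ∨' ◇ (◇ A))
  ¬⊡⇒◇∨◇◇ = tautology ((A ▷ ⊥') ∷ □ (A ▷ ⊥') ∷ []) (¬ˢ (x₀ ∧ˢ x₁) ⟶ (¬ˢ (¬ˢ x₀) ⟶ ¬ˢ x₁))
  ◇◇▷ : IL⊢ (◇ (◇ A) ▷ A)
  ◇◇▷ = ▷-trans (axJ5 (◇ A)) (axJ5 A)

ILP⊢⇒IL⊢♯ : ∀ {φ} → ILP⊢ φ → IL⊢ (φ ♯)
ILP⊢⇒IL⊢♯ (taut {φ} t) = taut (Taut-♯ {φ} t)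
ILP⊢⇒IL⊢♯ (axK φ ψ) = axK-♯ (φ ♯) (ψ ♯)
ILP⊢⇒IL⊢♯ (ax4 φ) = ⊡⇒⊡□⊡
ILP⊢⇒IL⊢♯ (axL φ) = axL-♯ (φ ♯)
ILP⊢⇒IL⊢♯ (axJ1 φ ψ) = ⊡-mono (axJ1 (φ ♯) (ψ ♯))
ILP⊢⇒IL⊢♯ (axJ2 φ χ ψ) = ⊡-mono₂ (axJ2 (φ ♯) (χ ♯) (ψ ♯))
ILP⊢⇒IL⊢♯ (axJ3 φ χ ψ) = ⊡-mono₂ (axJ3 (φ ♯) (χ ♯) (ψ ♯))
ILP⊢⇒IL⊢♯ (axJ4 φ ψ) = axJ4-♯ (φ ♯) (ψ ♯)
ILP⊢⇒IL⊢♯ (axJ5 φ) = axJ5-♯ (φ ♯)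
ILP⊢⇒IL⊢♯ (axP φ ψ) = ⊡⇒⊡□⊡
ILP⊢⇒IL⊢♯ (mp h₁ h₂) = mp (ILP⊢⇒IL⊢♯ h₁) (ILP⊢⇒IL⊢♯ h₂)
ILP⊢⇒IL⊢♯ (nec h) = ⊡-nec (nec (ILP⊢⇒IL⊢♯ h))

mainTheorem14 : (φ : Fm)
    → ((n : ℕ) → (n ∈ voc φ) ⇔ (n ∈ voc (φ ♯)))
      × (ILP⊢ (φ ⇔' (φ ♯)))
      × (ILP⊢ φ → IL⊢ (φ ♯))
mainTheorem14 φ = (λ n → voc-♯ φ) , ILP⊢⇔♯ φ , ILP⊢⇒IL⊢♯
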